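{- Let $z,w\in P-C$ with $\mathrm{dn}(z)<\mathrm{up}(w)$ and $w\leq z$ in $P$. If $C'$ is a chain in $P-C$ with least element $w$ and greatest element $z$, then $|C'|\leq 4k-4$.
   Context: Fix an integer $k\geq 2$ and a poset $P$ that excludes $\mathbf{k}+\mathbf{k}$. Let $h$ be the height of $P$ and $C=\{c_1<\cdots<c_h\}$ a chain in $P$ of size $h$. For $z\in P-C$, define $\mathrm{dn}(z)=0$ if $z$ is incomparable with $c_1$, and otherwise the greatest $i\in\{1,\ldots,h\}$ with $z>c_i$; define $\mathrm{up}(z)=h+1$ if $z$ is incomparable with $c_h$, and otherwise the least $j\in\{1,\ldots,h\}$ with $z<c_j$. -}

module Defs where

open import Data.Nat using (ℕ; zero; suc; _+_; _∸_; _*_; _≤_; _<_)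
open import Data.Fin using (Fin; toℕ)
open import Data.List using (List; length)
open import Data.List.Membership.Propositional using (_∈_)
open import Data.List.Relation.Unary.Unique.Propositional using (Unique)
open import Data.Product using (Σ; _×_; ∃)
open import Data.Sum using (_⊎_)
open import Relation.Nullary using (¬_)
open import Relation.Binary.PropositionalEquality using (_≡_; _≢_)
open import Relation.Binary.Structures using (IsPartialOrder)

record FinPoset (n : ℕ) : Set₁ where
  field
    _≼_ : Fin n → Fin n → Set
    isPartialOrder : IsPartialOrder _≡_ _≼_

module _ {n : ℕ} (P : FinPoset n) where
  open FinPoset P

  _≺_ : Fin n → Fin n → Set
  x ≺ y = (x ≼ y) × (x ≢ y)

  Comparable : Fin n → Fin n → Set
  Comparable x y = (x ≼ y) ⊎ (y ≼ x)

  Incomparable : Fin n → Fin n → Set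
  Incomparable x y = ¬ Comparable x y

  IsChain : List (Fin n) → Set
  IsChain L = Unique L × (∀ {x y} → x ∈ L → y ∈ L → Comparable x y)

  -- P contains a copy of k + k: two chains of size k, every element of
  -- one incomparable to every element of the other
  ContainsKPlusK : ℕ → Set
  ContainsKPlusK k = Σ (List (Fin n)) λ A → Σ (List (Fin n)) λ B →
    IsChain A × IsChain B × length A ≡ k × length B ≡ k ×
    (∀ {a b} → a ∈ A → b ∈ B → Incomparable a b)

  ExcludesKPlusK : ℕ → Set
  ExcludesKPlusK k = ¬ ContainsKPlusK k

  -- h is the height of P: no chain has more than h elements
  -- (existence of a chain of size h is supplied by c below)
  HeightAtMost : ℕ → Set
  HeightAtMost h = ∀ L → IsChain L → length L ≤ h

  -- c : Fin h → Fin n is the chain c_1 < ... < c_h (c i is c_{i+1})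
  IsStrictChainMap : {h : ℕ} → (Fin h → Fin n) → Set
  IsStrictChainMap {h} c = ∀ (i j : Fin h) → toℕ i < toℕ j → c i ≺ c j

  NotInC : {h : ℕ} → (Fin h → Fin n) → Fin n → Set
  NotInC {h} c z = ∀ (i : Fin h) → z ≢ c i

  IsDn : {h : ℕ} → (Fin h → Fin n) → Fin n → ℕ → Set
  IsDn {h} c z d =
    (d ≡ 0 × (∀ (i : Fin h) → toℕ i ≡ 0 → Incomparable z (c i)))
    ⊎ (Σ (Fin h) λ i → d ≡ suc (toℕ i) × c i ≺ z ×
         (∀ (j : Fin h) → c j ≺ z → toℕ j ≤ toℕ i))

  IsUp : {h : ℕ} → (Fin h → Fin n) → Fin n → ℕ → Set
  IsUp {h} c z u =
    (u ≡ suc h × (∀ (i : Fin h) → suc (toℕ i) ≡ h → Incomparable z (c i)))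
    ⊎ (Σ (Fin h) λ j → u ≡ suc (toℕ j) × z ≺ c j ×
         (∀ (i : Fin h) → z ≺ c i → toℕ j ≤ toℕ i))

module Submission where

-- Suppose |C'| ≥ 2k and list C' increasingly.  Let x be its k-th
-- element from below and y its k-th element from above, so C' splits into a
-- k-chain in [w, x], a k-chain in [y, z] and the chain Mid = C' ∩ [x, y].
-- Classify the indices i of C: c_i < x ("below"), y < c_i ("above"), or
-- else — since dn(z) < up(w) forbids w < c_i < z — c_i is incomparable to
-- all of [w, x] or to all of [y, z].  Excluding k + k, each of the last two
-- classes has fewer than k members.  Stacking the c_i below x, then Mid, then
-- the c_i above y gives a chain, so by maximality of h we get
-- |Mid| ≤ 2k − 2, i.e. |C'| ≤ (k−1) + (2k−2) + (k−1) = 4k − 4.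
--
-- The comparability relation
-- of P need not be decidable; as the conclusion is a decidable statement
-- about ℕ, we may nevertheless assume decidability ('¬¬-decidable').

open import Defs
open import Data.Nat using (ℕ; _≤_; _<_; _*_; _∸_)
open import Data.Fin using (Fin)
open import Data.List using (List; length)
open import Data.List.Membership.Propositional using (_∈_)
open import Data.List.Relation.Unary.All using (All)

open import Data.Nat using (zero; suc; _+_; z≤n; s≤s; _≤?_; _<?_)
open import Data.Nat.Properties
  using (≤-refl; ≤-trans; ≤-reflexive; n≤1+n; m≤m+n; +-suc; +-comm; +-mono-≤; +-monoʳ-≤;
         +-cancelˡ-≤; +-cancelʳ-≤; *-suc; m+n∸m≡n; ≰⇒>; ≮⇒≥; <-irrefl; m≤n⇒m<n∨m≡n;
         m≤n⇒m⊓n≡m; m≤n⇒∃[o]m+o≡n; suc-injective; module ≤-Reasoning)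
open import Data.Nat.Tactic.RingSolver using (solve-∀)
import Data.Fin as F
open import Data.Fin using (toℕ)
import Data.Fin.Properties as FinP
open import Data.List using ([]; _∷_; _++_; map; filter; take; allFin)
open import Data.List.Properties using (length-++; length-map; length-take; length-tabulate; filter-all)
open import Data.List.Membership.Propositional.Properties using (∈-map⁻; ∈-++⁻; ∈-filter⁻)
import Data.List.Relation.Unary.All as All
import Data.List.Relation.Unary.All.Properties as All
open import Data.List.Relation.Unary.All using ([]; _∷_)
open import Data.List.Relation.Unary.Any using (here; there)
open import Data.List.Relation.Unary.AllPairs as AP using (AllPairs; []; _∷_)
import Data.List.Relation.Unary.AllPairs.Properties as AP
import Data.List.Relation.Unary.Unique.Propositional.Properties as Unique
import Data.List.Relation.Binary.Sublist.Propositional as Sublist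
open import Data.List.Relation.Binary.Sublist.Propositional.Properties using (take-⊆)
open import Data.Product using (Σ; _×_; _,_; proj₁; proj₂; ∃)
open import Data.Sum using (_⊎_; inj₁; inj₂; [_,_]; [_,_]′)
open import Data.Empty using (⊥-elim)
open import Data.Unit using (⊤; tt)
open import Data.Bool using (true; false)
open import Relation.Nullary using (¬_; Dec; yes; no; does)
open import Relation.Nullary.Decidable using (¬?; _×-dec_; decidable-stable; toSum)
open import Relation.Nullary.Decidable.Core using (¬¬-excluded-middle)
open import Relation.Unary using (Decidable)
open import Relation.Binary.PropositionalEquality using (_≡_; refl; sym; trans; cong; cong₂; subst; subst₂)
open import Relation.Binary.Structures using (IsPartialOrder)

split-at : ∀ {A : Set} a b (L : List A) → length L ≡ a + suc b →
  Σ (List A) λ X → Σ A λ x → Σ (List A) λ R →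
    L ≡ X ++ x ∷ R × length X ≡ a × length R ≡ b
split-at zero    b (x ∷ R) len = [] , x , R , refl , refl , suc-injective len
split-at (suc a) b (y ∷ L) len with split-at a b L (suc-injective len)
... | X , x , R , refl , lenX , lenR = y ∷ X , x , R , refl , cong suc lenX , lenR

module _ {A : Set} {R : A → A → Set} where

  AllPairs-++⁻ : ∀ xs {ys} → AllPairs R (xs ++ ys) →
    AllPairs R xs × AllPairs R ys × All (λ a → All (R a) ys) xs
  AllPairs-++⁻ []       Rys        = [] , Rys , []
  AllPairs-++⁻ (x ∷ xs) (Rx ∷ Rxys) with AllPairs-++⁻ xs Rxys
  ... | Rxs , Rys , cross = All.++⁻ˡ xs Rx ∷ Rxs , Rys , All.++⁻ʳ xs Rx ∷ cross

  AllPairs-cut : ∀ xs {y ys} → AllPairs R (xs ++ y ∷ ys) → AllPairs R (xs ++ y ∷ [])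
  AllPairs-cut xs Rxyys with AllPairs-++⁻ xs Rxyys
  ... | Rxs , _ , cross = AP.++⁺ Rxs ([] ∷ []) (All.map (λ Rx → All.head Rx ∷ []) cross)

filter-∷-≤ : ∀ {A : Set} {P : A → Set} (P? : Decidable P) x xs →
  length (filter P? xs) ≤ length (filter P? (x ∷ xs))
filter-∷-≤ P? x xs with does (P? x)
... | true  = n≤1+n _
... | false = ≤-refl

filter-cover : ∀ {A : Set} {R P Q : A → Set}
  (R? : Decidable R) (P? : Decidable P) (Q? : Decidable Q) →
  (∀ {a} → R a → P a ⊎ Q a) → ∀ xs →
  length (filter R? xs) ≤ length (filter P? xs) + length (filter Q? xs)
filter-cover R? P? Q? cover [] = z≤n
filter-cover R? P? Q? cover (x ∷ xs) with R? x
... | no _ = ≤-trans (filter-cover R? P? Q? cover xs)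
                     (+-mono-≤ (filter-∷-≤ P? x xs) (filter-∷-≤ Q? x xs))
... | yes r with P? x
...   | yes _ = s≤s (≤-trans (filter-cover R? P? Q? cover xs)
                             (+-monoʳ-≤ _ (filter-∷-≤ Q? x xs)))
...   | no ¬p with Q? x
...     | yes _ = ≤-trans (s≤s (filter-cover R? P? Q? cover xs)) (≤-reflexive (sym (+-suc _ _)))
...     | no ¬q = ⊥-elim ([ ¬p , ¬q ] (cover r))

¬¬-Fin-∀ : ∀ m {Q : Fin m → Set} → (∀ i → ¬ ¬ Q i) → ¬ ¬ (∀ i → Q i)
¬¬-Fin-∀ zero    ¬¬Q ¬∀Q = ¬∀Q (λ ())
¬¬-Fin-∀ (suc m) ¬¬Q ¬∀Q = ¬¬Q F.zero λ Q₀ →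
  ¬¬-Fin-∀ m (λ i → ¬¬Q (F.suc i)) λ Qₛ → ¬∀Q λ { F.zero → Q₀ ; (F.suc i) → Qₛ i }

¬¬-decidable : ∀ {m} (R : Fin m → Fin m → Set) → ¬ ¬ (∀ a b → Dec (R a b))
¬¬-decidable {m} R = ¬¬-Fin-∀ m λ a → ¬¬-Fin-∀ m λ b → ¬¬-excluded-middle

squeeze : ∀ {lo mid hi a b h k} → lo + (mid + hi) ≤ h → h ≤ lo + (hi + (a + b)) →
  a < k → b < k → 2 + mid ≤ k + k
squeeze {lo} {mid} {hi} {a} {b} {k = k} tower cover a<k b<k =
  ≤-trans (s≤s (s≤s mid≤a+b)) (subst (_≤ k + k) (cong suc (+-suc a b)) (+-mono-≤ a<k b<k))
  where
    mid≤a+b : mid ≤ a + b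
    mid≤a+b = +-cancelʳ-≤ hi mid (a + b)
      (subst (mid + hi ≤_) (+-comm hi (a + b)) (+-cancelˡ-≤ lo _ _ (≤-trans tower cover)))

4k∸4 : ∀ k′ → 4 * suc k′ ∸ 4 ≡ (k′ + k′) + (k′ + k′)
4k∸4 k′ = trans (cong (_∸ 4) (*-suc 4 k′)) (trans (m+n∸m≡n 4 (4 * k′)) (quadruple k′))
  where
    quadruple : ∀ m → 4 * m ≡ (m + m) + (m + m)
    quadruple = solve-∀

short-arith : ∀ {k′} → 1 ≤ k′ → suc (k′ + k′) ≤ 4 * suc k′ ∸ 4
short-arith {k′} k′≥1 = subst (suc (k′ + k′) ≤_) (sym (4k∸4 k′))
  (subst (_≤ (k′ + k′) + (k′ + k′)) (+-comm (k′ + k′) 1)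
    (+-monoʳ-≤ (k′ + k′) (≤-trans k′≥1 (m≤m+n k′ k′))))

long-arith : ∀ k′ t → 2 + (2 + t) ≤ suc k′ + suc k′ → 2 + (k′ + k′) + t ≤ 4 * suc k′ ∸ 4
long-arith k′ t middle≤ = subst₂ _≤_ (reorder k′ t) (sym (4k∸4 k′)) (+-monoʳ-≤ (k′ + k′) 2+t≤)
  where
    2+t≤ : 2 + t ≤ k′ + k′
    2+t≤ = +-cancelˡ-≤ 2 (2 + t) (k′ + k′)
             (subst (2 + (2 + t) ≤_) (cong suc (+-suc k′ k′)) middle≤)
    reorder : ∀ k′ t → (k′ + k′) + (2 + t) ≡ 2 + (k′ + k′) + t
    reorder = solve-∀

-- The position of the split points in a chain of 2k + t elements.
layout : ∀ k′ t → 2 + (k′ + k′) + t ≡ k′ + suc (t + suc k′)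
layout = solve-∀

module Chains {n : ℕ} (P : FinPoset n) where
  open FinPoset P
  open IsPartialOrder isPartialOrder
    using () renaming (refl to ≼-refl; trans to ≼-trans; antisym to ≼-antisym; reflexive to ≼-reflexive)

  _⊏_ : Fin n → Fin n → Set
  _⊏_ = _≺_ P

  ⊏-≼-trans : ∀ {a b d} → a ⊏ b → b ≼ d → a ⊏ d
  ⊏-≼-trans (a≼b , a≢b) b≼d = ≼-trans a≼b b≼d , λ { refl → a≢b (≼-antisym a≼b b≼d) }

  ≼-⊏-trans : ∀ {a b d} → a ≼ b → b ⊏ d → a ⊏ d
  ≼-⊏-trans a≼b (b≼d , b≢d) = ≼-trans a≼b b≼d , λ { refl → b≢d (≼-antisym b≼d a≼b) }

  Increasing : List (Fin n) → Set
  Increasing = AllPairs _⊏_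

  increasing⇒chain : ∀ {L} → Increasing L → IsChain P L
  increasing⇒chain inc = AP.map proj₂ inc , comparable inc
    where
      comparable : ∀ {L} → Increasing L → ∀ {a b} → a ∈ L → b ∈ L → Comparable P a b
      comparable _           (here refl) (here refl) = inj₁ ≼-refl
      comparable (a⊏ ∷ _)    (here refl) (there b∈) = inj₁ (proj₁ (All.lookup a⊏ b∈))
      comparable (b⊏ ∷ _)    (there a∈) (here refl) = inj₂ (proj₁ (All.lookup b⊏ a∈))
      comparable (_ ∷ inc′)  (there a∈) (there b∈) = comparable inc′ a∈ b∈

  insert : ∀ v S → Increasing S → ¬ v ∈ S → (∀ {u} → u ∈ S → Comparable P v u) →
    Σ (List (Fin n)) λ S′ → Increasing S′ × length S′ ≡ suc (length S) ×
      (∀ {u} → u ∈ S′ → u ≡ v ⊎ u ∈ S)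
  insert v [] _ _ _ = v ∷ [] , [] ∷ [] , refl , λ { (here eq) → inj₁ eq }
  insert v (s ∷ S) inc@(s⊏S ∷ incS) v∉ cmp with cmp (here refl)
  ... | inj₁ v≼s =
          v ∷ s ∷ S , (v⊏s ∷ All.map (λ s⊏u → ⊏-≼-trans v⊏s (proj₁ s⊏u)) s⊏S) ∷ inc , refl ,
          λ { (here eq) → inj₁ eq ; (there u∈) → inj₂ u∈ }
    where
      v⊏s : v ⊏ s
      v⊏s = v≼s , λ v≡s → v∉ (here v≡s)
  ... | inj₂ s≼v with insert v S incS (λ v∈ → v∉ (there v∈)) (λ u∈ → cmp (there u∈))
  ...   | S′ , incS′ , len , mem =
          s ∷ S′ , All.tabulate s⊏ ∷ incS′ , cong suc len ,
          λ { (here eq) → inj₂ (here eq)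
            ; (there u∈) → [ inj₁ , (λ u∈S → inj₂ (there u∈S)) ]′ (mem u∈) }
    where
      s⊏ : ∀ {u} → u ∈ S′ → s ⊏ u
      s⊏ u∈ with mem u∈
      ... | inj₁ refl = s≼v , λ s≡v → v∉ (here (sym s≡v))
      ... | inj₂ u∈S  = All.lookup s⊏S u∈S

  chain⇒increasing : ∀ L → IsChain P L →
    Σ (List (Fin n)) λ S → Increasing S × length S ≡ length L × (∀ {u} → u ∈ S → u ∈ L)
  chain⇒increasing [] _ = [] , [] , refl , λ ()
  chain⇒increasing (v ∷ L) (v∉L ∷ uniqueL , cmp)
    with chain⇒increasing L (uniqueL , λ a∈ b∈ → cmp (there a∈) (there b∈))
  ... | S , incS , lenS , S⊆L
    with insert v S incS (λ v∈S → All.lookup v∉L (S⊆L v∈S) refl)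
                         (λ u∈ → cmp (here refl) (there (S⊆L u∈)))
  ...   | S′ , incS′ , lenS′ , mem =
          S′ , incS′ , trans lenS′ (cong suc lenS) ,
          λ u∈ → [ here , (λ u∈S → there (S⊆L u∈S)) ]′ (mem u∈)

  few-incomparable : ∀ {k X Y} → ExcludesKPlusK P k → IsChain P X → length X ≡ k → IsChain P Y →
    (∀ {a b} → a ∈ X → b ∈ Y → Incomparable P a b) → length Y < k
  few-incomparable {k} {X} {Y} excl chX lenX chY inc with length Y <? k
  ... | yes short = short
  ... | no ¬short =
    ⊥-elim (excl (X , take k Y , chX , chain-take , lenX , length-take-k , λ a∈ b∈ → inc a∈ (∈-take b∈)))
    where
      ∈-take : ∀ {b} → b ∈ take k Y → b ∈ Y
      ∈-take = Sublist.lookup (take-⊆ k Y)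
      chain-take : IsChain P (take k Y)
      chain-take = Unique.take⁺ k (proj₁ chY) , λ a∈ b∈ → proj₂ chY (∈-take a∈) (∈-take b∈)
      length-take-k : length (take k Y) ≡ k
      length-take-k = trans (length-take k Y) (m≤n⇒m⊓n≡m (≮⇒≥ ¬short))

  module Window (X₀ : List (Fin n)) (x : Fin n) (M : List (Fin n)) (y : Fin n) (Y₀ : List (Fin n))
                (inc : Increasing (X₀ ++ x ∷ (M ++ y ∷ Y₀))) where

    lower middle upper : List (Fin n)
    lower  = X₀ ++ x ∷ []
    middle = x ∷ (M ++ y ∷ [])
    upper  = y ∷ Y₀

    private
      x∷R-increasing : Increasing (x ∷ (M ++ y ∷ Y₀))
      x∷R-increasing = proj₁ (proj₂ (AllPairs-++⁻ X₀ inc))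
      x⊏R : All (x ⊏_) (M ++ y ∷ Y₀)
      x⊏R = AP.head x∷R-increasing
      M⊏y : All (_⊏ y) M
      M⊏y = All.map All.head (proj₂ (proj₂ (AllPairs-++⁻ M (AP.tail x∷R-increasing))))

    lower-increasing : Increasing lower
    lower-increasing = AllPairs-cut X₀ inc

    middle-increasing : Increasing middle
    middle-increasing = AllPairs-cut (x ∷ M) x∷R-increasing

    upper-increasing : Increasing upper
    upper-increasing = proj₁ (proj₂ (AllPairs-++⁻ M (AP.tail x∷R-increasing)))

    x≼y : x ≼ y
    x≼y = proj₁ (All.head (All.++⁻ʳ M x⊏R))

    lower-below : All (_≼ x) lower
    lower-below =
      All.++⁺ (All.map (λ a⊏ → proj₁ (All.head a⊏)) (proj₂ (proj₂ (AllPairs-++⁻ X₀ inc)))) (≼-refl ∷ [])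

    middle-between : All (λ u → x ≼ u × u ≼ y) middle
    middle-between = (≼-refl , x≼y) ∷ All.++⁺
      (All.zipWith (λ (x⊏u , u⊏y) → proj₁ x⊏u , proj₁ u⊏y) (All.++⁻ˡ M x⊏R , M⊏y))
      ((x≼y , ≼-refl) ∷ [])

    upper-above : All (y ≼_) upper
    upper-above = ≼-refl ∷ All.map proj₁ (AP.head upper-increasing)

    length-lower : length lower ≡ suc (length X₀)
    length-lower = trans (length-++ X₀) (+-comm (length X₀) 1)

    length-middle : length middle ≡ 2 + length M
    length-middle = cong suc (trans (length-++ M) (+-comm (length M) 1))

    restrict : ∀ {Q : Fin n → Set} → All Q (X₀ ++ x ∷ (M ++ y ∷ Y₀)) →
      All Q lower × All Q middle × All Q upper
    restrict all with All.++⁻ X₀ all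
    ... | QX₀ , Qx ∷ QR with All.++⁻ M QR
    ...   | QM , Qy ∷ QY₀ = All.++⁺ QX₀ (Qx ∷ []) , Qx ∷ All.++⁺ QM (Qy ∷ []) , Qy ∷ QY₀

  module _ {h} {c : Fin h → Fin n} (sc : IsStrictChainMap P c) where

    c-monotone : ∀ {i j} → toℕ i ≤ toℕ j → c i ≼ c j
    c-monotone {i} {j} i≤j with m≤n⇒m<n∨m≡n i≤j
    ... | inj₁ i<j = proj₁ (sc i j i<j)
    ... | inj₂ i≡j = ≼-reflexive (cong c (FinP.toℕ-injective i≡j))

    image-increasing : ∀ {Q : Fin h → Set} (Q? : Decidable Q) → Increasing (map c (filter Q? (allFin h)))
    image-increasing Q? =
      AP.map⁺ (AP.map (λ {i} {j} → sc i j) (AP.filter⁺ Q? (AP.tabulate⁺-< (λ i<j → i<j))))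

  dn<up⇒separated : ∀ {h} {c : Fin h → Fin n} → IsStrictChainMap P c → ∀ {z w dz uw} →
    IsDn P c z dz → IsUp P c w uw → dz < uw → ∀ i → ¬ (w ⊏ c i × c i ⊏ z)
  dn<up⇒separated {zero} _ _ _ _ ()
  dn<up⇒separated {suc h′} sc (inj₁ (_ , z∥c₁)) _ _ i (_ , ci⊏z) =
    z∥c₁ F.zero refl (inj₂ (≼-trans (c-monotone sc z≤n) (proj₁ ci⊏z)))
  dn<up⇒separated {suc h′} {c} sc (inj₂ _) (inj₁ (_ , w∥cₕ)) _ i (w⊏ci , _) =
    w∥cₕ (F.fromℕ h′) (cong suc (FinP.toℕ-fromℕ h′)) (inj₁ (≼-trans (proj₁ w⊏ci) ci≼cₕ))
    where
      ci≼cₕ : c i ≼ c (F.fromℕ h′)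
      ci≼cₕ = c-monotone sc (subst (toℕ i ≤_) (sym (FinP.toℕ-fromℕ h′)) (FinP.toℕ≤pred[n] i))
  dn<up⇒separated {suc h′} sc (inj₂ (_ , refl , _ , dn-max)) (inj₂ (_ , refl , _ , up-min)) dz<uw
                  i (w⊏ci , ci⊏z) =
    <-irrefl refl (≤-trans dz<uw (s≤s (≤-trans (up-min i w⊏ci) (dn-max i ci⊏z))))

module Setting {n : ℕ} (P : FinPoset n) (dec : ∀ a b → Dec (FinPoset._≼_ P a b))
  (k′ : ℕ) (excl : ExcludesKPlusK P (suc k′))
  {h : ℕ} (c : Fin h → Fin n) (sc : IsStrictChainMap P c) (height : HeightAtMost P h)
  (w z : Fin n) (w∉C : NotInC P c w) (z∉C : NotInC P c z)
  (separated : ∀ i → ¬ (_≺_ P w (c i) × _≺_ P (c i) z)) where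

  open FinPoset P
  open IsPartialOrder isPartialOrder using () renaming (trans to ≼-trans)
  open Chains P

  _⊏?_ : ∀ a b → Dec (a ⊏ b)
  a ⊏? b with dec a b | a F.≟ b
  ... | yes a≼b | no a≢b = yes (a≼b , a≢b)
  ... | yes _   | yes a≡b = no (λ a⊏b → proj₂ a⊏b a≡b)
  ... | no a⋠b  | _       = no (λ a⊏b → a⋠b (proj₁ a⊏b))

  indices : {Q : Fin h → Set} → Decidable Q → List (Fin h)
  indices Q? = filter Q? (allFin h)

  count : {Q : Fin h → Set} → Decidable Q → ℕ
  count Q? = length (indices Q?)

  image : {Q : Fin h → Set} → Decidable Q → List (Fin n)
  image Q? = map c (indices Q?)

  image-member : ∀ {Q : Fin h → Set} (Q? : Decidable Q) {u} → u ∈ image Q? →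
    ∃ λ i → Q i × u ≡ c i
  image-member Q? u∈ with ∈-map⁻ c u∈
  ... | i , i∈ , refl = i , proj₂ (∈-filter⁻ Q? {xs = allFin h} i∈) , refl

  Below? : ∀ x → Decidable (λ i → c i ⊏ x)
  Below? x i = c i ⊏? x

  Above? : ∀ y → Decidable (λ i → y ⊏ c i)
  Above? y i = y ⊏? c i

  GapBelow? : ∀ x → Decidable (λ i → ¬ (c i ⊏ x) × ¬ (w ⊏ c i))
  GapBelow? x i = ¬? (c i ⊏? x) ×-dec ¬? (w ⊏? c i)

  GapAbove? : ∀ y → Decidable (λ i → ¬ (c i ⊏ z) × ¬ (y ⊏ c i))
  GapAbove? y i = ¬? (c i ⊏? z) ×-dec ¬? (y ⊏? c i)

  -- Each index is below x, above y, or in one of the two gaps (this is where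
  -- the separation of w and z is used), so h is at most the sum of the sizes.
  index-cover : ∀ x y →
    h ≤ count (Below? x) + (count (Above? y) + (count (GapBelow? x) + count (GapAbove? y)))
  index-cover x y = begin
    h                                  ≡⟨ every-index-counted ⟩
    count all?                         ≤⟨ count-cover all? (Below? x) notBelow? (λ {i} _ → toSum (Below? x i)) ⟩
    count (Below? x) + count notBelow? ≤⟨ +-monoʳ-≤ (count (Below? x))
                                            (count-cover notBelow? (Above? y) neither? above-or-neither) ⟩
    count (Below? x) + (count (Above? y) + count neither?)
                                       ≤⟨ +-monoʳ-≤ (count (Below? x)) (+-monoʳ-≤ (count (Above? y))
                                            (count-cover neither? (GapBelow? x) (GapAbove? y) in-a-gap)) ⟩
    count (Below? x) + (count (Above? y) + (count (GapBelow? x) + count (GapAbove? y))) ∎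
    where
      open ≤-Reasoning
      count-cover : ∀ {R P Q : Fin h → Set} (R? : Decidable R) (P? : Decidable P) (Q? : Decidable Q) →
        (∀ {i} → R i → P i ⊎ Q i) → count R? ≤ count P? + count Q?
      count-cover R? P? Q? R⊆P∪Q = filter-cover R? P? Q? R⊆P∪Q (allFin h)
      all? : Decidable (λ (_ : Fin h) → ⊤)
      all? _ = yes tt
      every-index-counted : h ≡ count all?
      every-index-counted = trans (sym (length-tabulate {A = Fin h} (λ i → i)))
        (sym (cong length (filter-all all? {xs = allFin h} (All.tabulate (λ _ → tt)))))
      notBelow? : Decidable (λ i → ¬ (c i ⊏ x))
      notBelow? i = ¬? (Below? x i)
      neither? : Decidable (λ i → ¬ (c i ⊏ x) × ¬ (y ⊏ c i))
      neither? i = notBelow? i ×-dec ¬? (Above? y i)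
      above-or-neither : ∀ {i} → ¬ (c i ⊏ x) → y ⊏ c i ⊎ (¬ (c i ⊏ x) × ¬ (y ⊏ c i))
      above-or-neither {i} ¬below with Above? y i
      ... | yes above = inj₁ above
      ... | no ¬above = inj₂ (¬below , ¬above)
      in-a-gap : ∀ {i} → ¬ (c i ⊏ x) × ¬ (y ⊏ c i) →
        (¬ (c i ⊏ x) × ¬ (w ⊏ c i)) ⊎ (¬ (c i ⊏ z) × ¬ (y ⊏ c i))
      in-a-gap {i} (¬below , ¬above) with w ⊏? c i | c i ⊏? z
      ... | no w⋢ci | _         = inj₁ (¬below , w⋢ci)
      ... | yes _   | no ci⋢z   = inj₂ (ci⋢z , ¬above)
      ... | yes w⊏ci | yes ci⊏z = ⊥-elim (separated i (w⊏ci , ci⊏z))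

  -- The gap below x has fewer than k elements: they are incomparable to the
  -- k-chain X inside [w, x].
  gap-below-bound : ∀ {x X} → NotInC P c x → Increasing X → length X ≡ suc k′ →
    All (λ a → w ≼ a × a ≼ x) X → count (GapBelow? x) < suc k′
  gap-below-bound {x} {X} x∉C incX lenX X⊆[w,x] =
    subst (_< suc k′) (length-map c (indices (GapBelow? x)))
      (few-incomparable excl (increasing⇒chain incX) lenX
        (increasing⇒chain (image-increasing sc (GapBelow? x))) incomparable)
    where
      incomparable : ∀ {a b} → a ∈ X → b ∈ image (GapBelow? x) → Incomparable P a b
      incomparable a∈ b∈ with image-member (GapBelow? x) b∈ | All.lookup X⊆[w,x] a∈
      ... | i , (ci⋢x , w⋢ci) , refl | w≼a , a≼x =
        [ (λ a≼ci → w⋢ci (≼-trans w≼a a≼ci , λ w≡ci → w∉C i w≡ci))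
        , (λ ci≼a → ci⋢x (≼-trans ci≼a a≼x , λ ci≡x → x∉C i (sym ci≡x))) ]

  gap-above-bound : ∀ {y Y} → NotInC P c y → Increasing Y → length Y ≡ suc k′ →
    All (λ b → y ≼ b × b ≼ z) Y → count (GapAbove? y) < suc k′
  gap-above-bound {y} {Y} y∉C incY lenY Y⊆[y,z] =
    subst (_< suc k′) (length-map c (indices (GapAbove? y)))
      (few-incomparable excl (increasing⇒chain incY) lenY
        (increasing⇒chain (image-increasing sc (GapAbove? y))) incomparable)
    where
      incomparable : ∀ {a b} → a ∈ Y → b ∈ image (GapAbove? y) → Incomparable P a b
      incomparable a∈ b∈ with image-member (GapAbove? y) b∈ | All.lookup Y⊆[y,z] a∈
      ... | i , (ci⋢z , y⋢ci) , refl | y≼a , a≼z =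
        [ (λ a≼ci → y⋢ci (≼-trans y≼a a≼ci , λ y≡ci → y∉C i y≡ci))
        , (λ ci≼a → ci⋢z (≼-trans ci≼a a≼z , λ ci≡z → z∉C i (sym ci≡z))) ]

  tower-bound : ∀ {x y Mid} → x ≼ y → Increasing Mid → All (λ u → x ≼ u × u ≼ y) Mid →
    count (Below? x) + (length Mid + count (Above? y)) ≤ h
  tower-bound {x} {y} {Mid} x≼y incMid Mid⊆[x,y] =
    subst (_≤ h) tower-length (height tower (increasing⇒chain tower-increasing))
    where
      tower : List (Fin n)
      tower = image (Below? x) ++ (Mid ++ image (Above? y))
      above-y : ∀ {b} → b ∈ image (Above? y) → y ⊏ b
      above-y b∈ with image-member (Above? y) b∈
      ... | _ , y⊏ci , refl = y⊏ci
      upper-part : Increasing (Mid ++ image (Above? y))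
      upper-part = AP.++⁺ incMid (image-increasing sc (Above? y))
        (All.map (λ (_ , u≼y) → All.tabulate (λ b∈ → ≼-⊏-trans u≼y (above-y b∈))) Mid⊆[x,y])
      lies-above : ∀ {a b} → a ⊏ x → b ∈ Mid ++ image (Above? y) → a ⊏ b
      lies-above a⊏x b∈ with ∈-++⁻ Mid b∈
      ... | inj₁ b∈Mid = ⊏-≼-trans a⊏x (proj₁ (All.lookup Mid⊆[x,y] b∈Mid))
      ... | inj₂ b∈Above = ⊏-≼-trans a⊏x (≼-trans x≼y (proj₁ (above-y b∈Above)))
      tower-increasing : Increasing tower
      tower-increasing = AP.++⁺ (image-increasing sc (Below? x)) upper-part
        (All.tabulate λ a∈ → All.tabulate λ b∈ → lies-above (below-x a∈) b∈)
        where
          below-x : ∀ {a} → a ∈ image (Below? x) → a ⊏ x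
          below-x a∈ with image-member (Below? x) a∈
          ... | _ , ci⊏x , refl = ci⊏x
      tower-length : length tower ≡ count (Below? x) + (length Mid + count (Above? y))
      tower-length = trans (length-++ (image (Below? x)))
        (cong₂ _+_ (length-map c (indices (Below? x)))
                    (trans (length-++ Mid) (cong (length Mid +_) (length-map c (indices (Above? y))))))

  middle-bound : ∀ {x y X Mid Y} → NotInC P c x → NotInC P c y → x ≼ y →
    Increasing X → length X ≡ suc k′ → All (λ a → w ≼ a × a ≼ x) X →
    Increasing Y → length Y ≡ suc k′ → All (λ b → y ≼ b × b ≼ z) Y →
    Increasing Mid → All (λ u → x ≼ u × u ≼ y) Mid →
    2 + length Mid ≤ suc k′ + suc k′
  middle-bound {x} {y} x∉C y∉C x≼y incX lenX X⊆[w,x] incY lenY Y⊆[y,z] incMid Mid⊆[x,y] =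
    squeeze {lo = count (Below? x)} {hi = count (Above? y)}
            (tower-bound x≼y incMid Mid⊆[x,y]) (index-cover x y)
            (gap-below-bound x∉C incX lenX X⊆[w,x]) (gap-above-bound y∉C incY lenY Y⊆[y,z])

  chain-bound : 1 ≤ k′ → ∀ C′ → IsChain P C′ → All (NotInC P c) C′ →
    (∀ {u} → u ∈ C′ → w ≼ u) → (∀ {u} → u ∈ C′ → u ≼ z) →
    length C′ ≤ 4 * suc k′ ∸ 4
  chain-bound k′≥1 C′ chC′ C′∉C w≼C′ C′≼z with length C′ ≤? suc (k′ + k′)
  ... | yes short = ≤-trans short (short-arith k′≥1)
  ... | no ¬short with m≤n⇒∃[o]m+o≡n (≰⇒> ¬short) | chain⇒increasing C′ chC′
  ...   | t , len≡ | S , incS , lenS , S⊆C′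
    with split-at k′ (t + suc k′) S (trans lenS (trans (sym len≡) (layout k′ t)))
  ...   | X₀ , x , R , refl , lenX₀ , lenR with split-at t k′ R lenR
  ...   | M , y , Y₀ , refl , lenM , lenY₀ =
    subst (_≤ 4 * suc k′ ∸ 4) len≡
      (long-arith k′ t (subst (λ m → 2 + m ≤ suc k′ + suc k′)
                              (trans length-middle (cong (2 +_) lenM)) bound))
    where
      open Window X₀ x M y Y₀ incS
      located : All (λ u → NotInC P c u × w ≼ u × u ≼ z) (X₀ ++ x ∷ (M ++ y ∷ Y₀))
      located = All.tabulate λ u∈ →
        All.lookup C′∉C (S⊆C′ u∈) , w≼C′ (S⊆C′ u∈) , C′≼z (S⊆C′ u∈)
      bound : 2 + length middle ≤ suc k′ + suc k′
      bound with restrict located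
      ... | lower-located , (x∉C , _) ∷ _ , upper-located@((y∉C , _) ∷ _) =
        middle-bound x∉C y∉C x≼y
          lower-increasing (trans length-lower (cong suc lenX₀))
            (All.zipWith (λ ((_ , w≼a , _) , a≼x) → w≼a , a≼x) (lower-located , lower-below))
          upper-increasing (cong suc lenY₀)
            (All.zipWith (λ (y≼b , (_ , _ , b≼z)) → y≼b , b≼z) (upper-above , upper-located))
          middle-increasing middle-between

lemma3p3 : (k : ℕ) → 2 ≤ k → (n : ℕ) → (P : FinPoset n) →
    ExcludesKPlusK P k →
    (h : ℕ) → (c : Fin h → Fin n) →
    IsStrictChainMap P c → HeightAtMost P h →
    (z w : Fin n) → NotInC P c z → NotInC P c w →
    (dz uw : ℕ) → IsDn P c z dz → IsUp P c w uw → dz < uw →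
    FinPoset._≼_ P w z →
    (C' : List (Fin n)) → IsChain P C' → All (NotInC P c) C' →
    w ∈ C' → z ∈ C' →
    (∀ {x} → x ∈ C' → FinPoset._≼_ P w x) →
    (∀ {x} → x ∈ C' → FinPoset._≼_ P x z) →
    length C' ≤ 4 * k ∸ 4
lemma3p3 (suc k′) (s≤s k′≥1) _ P excl _ c sc height z w z∉C w∉C _ _ dn up dz<uw _
         C′ chC′ C′∉C _ _ w≼C′ C′≼z =
  decidable-stable (length C′ ≤? 4 * suc k′ ∸ 4) λ ¬bound →
    ¬¬-decidable (FinPoset._≼_ P) λ dec →
      ¬bound (Setting.chain-bound P dec k′ excl c sc height w z w∉C z∉C separated
                k′≥1 C′ chC′ C′∉C w≼C′ C′≼z)
  where
    separated : ∀ i → ¬ (_≺_ P w (c i) × _≺_ P (c i) z)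
    separated = Chains.dn<up⇒separated P sc dn up dz<uw
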